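{- Let $G=(V,E)$ be a connected graph and $c:V\to\mathbb{N}$ with $c_v\le d(v)$ for every $v\in V$, where $d(v)$ is the degree of $v$ in $G$. Run the following Edge Addition algorithm: start with $Y=\emptyset$; for each $e\in E$ (in any order), if $Y\cup\{e\}$ is feasible, replace $Y$ by $Y\cup\{e\}$. Let $d_Y(x)$ be the degree of $x$ in $(V,Y)$ and $A=\{v\in V: d_Y(v)<c_v\}$. Let $Z$ be obtained by selecting, for each $v\in A$, arbitrary $c_v-d_Y(v)$ edges of $E\setminus Y$ incident on $v$ and inserting them into $Z$ (initially $Z=\emptyset$). Output $Y$ if $|Y|\ge |Z|$ and $Z$ otherwise. Then the output set is feasible, i.e., satisfies the degree condition.
   Context: A set $E'\subseteq E$ is feasible (satisfies the degree condition) for $(G,c)$ if for every edge $(u,v)\in E'$ we have $d'_u\le c_u$ or $d'_v\le c_v$, where $d'_x$ denotes the degree of $x$ in the graph $(V,E')$. -}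

module Defs where

open import Data.Nat using (ℕ; _≤_; _<_; _∸_; _<?_; _≤?_)
open import Data.Fin using (Fin; _≟_)
open import Data.Fin.Properties using (all?)
open import Data.Fin.Subset using (Subset; _∈_; _∪_; _∩_; ⁅_⁆; ⊥; ⊤; ⋃; ∣_∣; ∁; _⊆_)
open import Data.Fin.Subset.Properties using (_∈?_)
open import Data.Fin.Permutation using (Permutation′; _⟨$⟩ʳ_)
open import Data.Product using (_×_; _,_; proj₁; proj₂; ∃)
open import Data.Sum using (_⊎_)
open import Data.Bool using (Bool; _∨_; if_then_else_)
open import Data.Vec using (tabulate)
open import Data.List using (List; filter; map; foldl)
import Data.List as L
open import Relation.Nullary using (Dec; ¬_; does)
open import Relation.Nullary.Decidable using (⌊_⌋; _⊎-dec_; _→-dec_)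
open import Relation.Binary.PropositionalEquality using (_≡_; _≢_)
open import Relation.Binary.Construct.Closure.ReflexiveTransitive using (Star)

-- A (multi)graph on vertex set Fin n with m edges, edge i having endpoints (E i).
Edges : ℕ → ℕ → Set
Edges n m = Fin m → Fin n × Fin n

SameEdge : ∀ {n} → Fin n × Fin n → Fin n × Fin n → Set
SameEdge (u , v) (u' , v') = (u ≡ u' × v ≡ v') ⊎ (u ≡ v' × v ≡ u')

Simple : ∀ {n m} → Edges n m → Set
Simple {n} {m} E = (∀ i → proj₁ (E i) ≢ proj₂ (E i))
                 × (∀ i j → SameEdge (E i) (E j) → i ≡ j)

Adjacent : ∀ {n m} → Edges n m → Fin n → Fin n → Set
Adjacent E u v = ∃ λ i → SameEdge (E i) (u , v)

Connected : ∀ {n m} → Edges n m → Set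
Connected E = ∀ u v → Star (Adjacent E) u v

incident : ∀ {n m} → Edges n m → Fin m → Fin n → Bool
incident E i x = ⌊ proj₁ (E i) ≟ x ⌋ ∨ ⌊ proj₂ (E i) ≟ x ⌋

inc : ∀ {n m} → Edges n m → Fin n → Subset m
inc E x = tabulate (λ i → incident E i x)

deg : ∀ {n m} → Edges n m → Subset m → Fin n → ℕ
deg E E' x = ∣ E' ∩ inc E x ∣

Feasible : ∀ {n m} → Edges n m → (Fin n → ℕ) → Subset m → Set
Feasible E c E' = ∀ i → i ∈ E' →
  deg E E' (proj₁ (E i)) ≤ c (proj₁ (E i)) ⊎ deg E E' (proj₂ (E i)) ≤ c (proj₂ (E i))

feasible? : ∀ {n m} (E : Edges n m) (c : Fin n → ℕ) (E' : Subset m) → Dec (Feasible E c E')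
feasible? E c E' = all? (λ i → (i ∈? E') →-dec
  ((deg E E' (proj₁ (E i)) ≤? c (proj₁ (E i))) ⊎-dec (deg E E' (proj₂ (E i)) ≤? c (proj₂ (E i)))))

addStep : ∀ {n m} → Edges n m → (Fin n → ℕ) → Subset m → Fin m → Subset m
addStep E c Y i = if does (feasible? E c (Y ∪ ⁅ i ⁆)) then Y ∪ ⁅ i ⁆ else Y

edgeAddition : ∀ {n m} → Edges n m → (Fin n → ℕ) → Permutation′ m → Subset m
edgeAddition {m = m} E c π = foldl (addStep E c) ⊥ (map (π ⟨$⟩ʳ_) (L.allFin m))

deficient : ∀ {n m} → Edges n m → (Fin n → ℕ) → Subset m → List (Fin n)
deficient {n} E c Y = filter (λ v → deg E Y v <? c v) (L.allFin n)

ValidSelection : ∀ {n m} → Edges n m → (Fin n → ℕ) → Subset m → (Fin n → Subset m) → Set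
ValidSelection E c Y S = ∀ v → deg E Y v < c v →
  (S v ⊆ (∁ Y ∩ inc E v)) × (∣ S v ∣ ≡ c v ∸ deg E Y v)

selectZ : ∀ {n m} → Edges n m → (Fin n → ℕ) → Subset m → (Fin n → Subset m) → Subset m
selectZ E c Y S = ⋃ (map S (deficient E c Y))

output : ∀ {n m} → Edges n m → (Fin n → ℕ) → Permutation′ m → (Fin n → Subset m) → Subset m
output E c π S =
  let Y = edgeAddition E c π
      Z = selectZ E c Y S
  in if does (∣ Z ∣ ≤? ∣ Y ∣) then Y else Z

module Submission where

-- * Y is feasible because every step of Edge Addition preserves feasibility.
--   Moreover Y is maximal: every edge either lies in Y or has a saturated
--   endpoint (d_Y(x) ≥ c_x).  Indeed, if adding a feasible set's missing edge
--   breaks feasibility, one of its endpoints is already saturated (adding an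
--   edge raises only the degrees of its endpoints, by at most one), and
--   saturation persists because Edge Addition only ever adds edges.
-- * Z is feasible for any maximal Y: an edge of Z taken from S w' that is also
--   incident on a deficient w ≠ w' would join two deficient vertices without
--   lying in Y, contradicting maximality.  Hence the Z-edges at a deficient w
--   all come from S w, so d_Z(w) ≤ |S w| = c_w - d_Y(w) ≤ c_w, and every edge
--   of Z has such an endpoint w.

open import Defs
open import Data.Nat using (ℕ; suc; _≤_; _<_; _<?_; _≤?_; _∸_; s≤s)
open import Data.Nat.Properties
  using (module ≤-Reasoning; ≤-refl; ≤-trans; n≤1+n; <⇒≤; ≮⇒≥; <⇒≱; m∸n≤m)
open import Data.Fin using (Fin; zero; suc; _≟_)
open import Data.Fin.Subset
  using (Subset; _∈_; _∉_; _∪_; _∩_; ⁅_⁆; ⊥; ⊤; ⋃; ∣_∣; ∁; _⊆_; inside; outside)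
open import Data.Fin.Subset.Properties
  using ( p⊆q⇒∣p∣≤∣q∣; x∈p∩q⁺; x∈p∩q⁻; x∈p∪q⁺; x∈p∪q⁻; p⊆p∪q; x∈⁅x⁆; x∈⁅y⁆⇒x≡y
        ; ∉⊥; x∈∁p⇒x∉p; ∪-identityʳ)
open import Data.Fin.Permutation using (Permutation′; _⟨$⟩ʳ_; _⟨$⟩ˡ_; inverseʳ)
open import Data.Product using (_×_; _,_; proj₁; proj₂; ∃)
open import Data.Sum using (_⊎_; inj₁; inj₂)
import Data.Sum as Sum
open import Data.Bool using (Bool; true; false; if_then_else_)
open import Data.Vec using (_∷_)
open import Data.Vec.Properties using ([]=⇒lookup; lookup∘tabulate)
open import Data.List using (List; []; _∷_; map; foldl; allFin)
import Data.List.Membership.Propositional as List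
open import Data.List.Membership.Propositional.Properties using (∈-map⁺; ∈-allFin; ∈-filter⁻)
import Data.List.Relation.Unary.Any as Any
open import Relation.Nullary using (Dec; yes; no; ¬_; does)
open import Relation.Nullary.Negation using (contradiction)
open import Relation.Binary.PropositionalEquality using (_≡_; _≢_; refl; sym; trans; subst)

if-preserves : ∀ {a p} {A : Set a} (P : A → Set p) (b : Bool) {x y : A} →
  P x → P y → P (if b then x else y)
if-preserves P true  px py = px
if-preserves P false px py = py

∣p∪⁅x⁆∣≤1+∣p∣ : ∀ {m} (p : Subset m) (x : Fin m) → ∣ p ∪ ⁅ x ⁆ ∣ ≤ suc ∣ p ∣
∣p∪⁅x⁆∣≤1+∣p∣ (inside  ∷ p) zero    rewrite ∪-identityʳ p = n≤1+n _
∣p∪⁅x⁆∣≤1+∣p∣ (outside ∷ p) zero    rewrite ∪-identityʳ p = ≤-refl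
∣p∪⁅x⁆∣≤1+∣p∣ (inside  ∷ p) (suc x) = s≤s (∣p∪⁅x⁆∣≤1+∣p∣ p x)
∣p∪⁅x⁆∣≤1+∣p∣ (outside ∷ p) (suc x) = ∣p∪⁅x⁆∣≤1+∣p∣ p x

∈-⋃-map : ∀ {a m} {A : Set a} (S : A → Subset m) (xs : List A) {j : Fin m} →
  j ∈ ⋃ (map S xs) → ∃ λ x → x List.∈ xs × j ∈ S x
∈-⋃-map S []       j∈ = contradiction j∈ ∉⊥
∈-⋃-map S (x ∷ xs) j∈ with x∈p∪q⁻ (S x) (⋃ (map S xs)) j∈
... | inj₁ j∈Sx = x , Any.here refl , j∈Sx
... | inj₂ j∈⋃  with ∈-⋃-map S xs j∈⋃
...   | y , y∈xs , j∈Sy = y , Any.there y∈xs , j∈Sy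

scheduled : ∀ {m} (π : Permutation′ m) i → i List.∈ map (π ⟨$⟩ʳ_) (allFin m)
scheduled {m} π i = subst (List._∈ map (π ⟨$⟩ʳ_) (allFin m)) (inverseʳ π)
  (∈-map⁺ (π ⟨$⟩ʳ_) (∈-allFin (π ⟨$⟩ˡ i)))

module _ {n m : ℕ} (E : Edges n m) (c : Fin n → ℕ) where

  src tgt : Fin m → Fin n
  src i = proj₁ (E i)
  tgt i = proj₂ (E i)

  Saturated Deficient : Subset m → Fin n → Set
  Saturated Y x = c x ≤ deg E Y x
  Deficient Y x = deg E Y x < c x

  deficient⇒¬saturated : ∀ {Y x} → Deficient Y x → ¬ Saturated Y x
  deficient⇒¬saturated = <⇒≱

  Settled : Subset m → Fin m → Set
  Settled Y i = i ∈ Y ⊎ (Saturated Y (src i) ⊎ Saturated Y (tgt i))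

  incident⇒endpoint : ∀ {j x} → j ∈ inc E x → src j ≡ x ⊎ tgt j ≡ x
  incident⇒endpoint {j} {x} j∈
    with trans (sym ([]=⇒lookup j∈)) (lookup∘tabulate (λ i → incident E i x) j)
  ... | _ with src j ≟ x | tgt j ≟ x
  ... | yes s≡x | _       = inj₁ s≡x
  ... | no _    | yes t≡x = inj₂ t≡x
  incident⇒endpoint j∈ | () | no _ | no _

  joins : ∀ {j w w'} → j ∈ inc E w → j ∈ inc E w' → w' ≢ w → SameEdge (E j) (w , w')
  joins j∈w j∈w' w'≢w with incident⇒endpoint j∈w | incident⇒endpoint j∈w'
  ... | inj₁ s≡w | inj₁ s≡w' = contradiction (trans (sym s≡w') s≡w) w'≢w
  ... | inj₁ s≡w | inj₂ t≡w' = inj₁ (s≡w , t≡w')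
  ... | inj₂ t≡w | inj₁ s≡w' = inj₂ (s≡w' , t≡w)
  ... | inj₂ t≡w | inj₂ t≡w' = contradiction (trans (sym t≡w') t≡w) w'≢w

  endpoints-deficient : ∀ {Y j w w'} → SameEdge (E j) (w , w') →
    Deficient Y w → Deficient Y w' → Deficient Y (src j) × Deficient Y (tgt j)
  endpoints-deficient {Y} (inj₁ (s≡w , t≡w')) w-def w'-def =
    subst (Deficient Y) (sym s≡w) w-def , subst (Deficient Y) (sym t≡w') w'-def
  endpoints-deficient {Y} (inj₂ (s≡w' , t≡w)) w-def w'-def =
    subst (Deficient Y) (sym s≡w') w'-def , subst (Deficient Y) (sym t≡w) w-def

  deficient-edge-unsettled : ∀ {Y j w w'} → j ∉ Y → SameEdge (E j) (w , w') →
    Deficient Y w → Deficient Y w' → ¬ Settled Y j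
  deficient-edge-unsettled j∉Y _ _ _ (inj₁ j∈Y) = j∉Y j∈Y
  deficient-edge-unsettled {Y} _ ends w-def w'-def (inj₂ (inj₁ s-sat)) =
    deficient⇒¬saturated {Y} (proj₁ (endpoints-deficient {Y} ends w-def w'-def)) s-sat
  deficient-edge-unsettled {Y} _ ends w-def w'-def (inj₂ (inj₂ t-sat)) =
    deficient⇒¬saturated {Y} (proj₂ (endpoints-deficient {Y} ends w-def w'-def)) t-sat

  deg-mono : ∀ {Y Y'} x → Y ⊆ Y' → deg E Y x ≤ deg E Y' x
  deg-mono {Y} x Y⊆Y' = p⊆q⇒∣p∣≤∣q∣ λ j∈ →
    let (j∈Y , j∈x) = x∈p∩q⁻ Y (inc E x) j∈ in x∈p∩q⁺ (Y⊆Y' j∈Y , j∈x)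

  settled-mono : ∀ {Y Y'} i → Y ⊆ Y' → Settled Y i → Settled Y' i
  settled-mono i Y⊆Y' (inj₁ i∈Y)        = inj₁ (Y⊆Y' i∈Y)
  settled-mono i Y⊆Y' (inj₂ (inj₁ sat)) = inj₂ (inj₁ (≤-trans sat (deg-mono (src i) Y⊆Y')))
  settled-mono i Y⊆Y' (inj₂ (inj₂ sat)) = inj₂ (inj₂ (≤-trans sat (deg-mono (tgt i) Y⊆Y')))

  deg-insert : ∀ Y e x → deg E (Y ∪ ⁅ e ⁆) x ≤ suc (deg E Y x)
  deg-insert Y e x = ≤-trans (p⊆q⇒∣p∣≤∣q∣ ⊆Y∩x∪⁅e⁆) (∣p∪⁅x⁆∣≤1+∣p∣ (Y ∩ inc E x) e)
    where
    ⊆Y∩x∪⁅e⁆ : (Y ∪ ⁅ e ⁆) ∩ inc E x ⊆ (Y ∩ inc E x) ∪ ⁅ e ⁆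
    ⊆Y∩x∪⁅e⁆ j∈ with x∈p∩q⁻ (Y ∪ ⁅ e ⁆) (inc E x) j∈
    ... | j∈Y∪e , j∈x with x∈p∪q⁻ Y ⁅ e ⁆ j∈Y∪e
    ...   | inj₁ j∈Y = x∈p∪q⁺ (inj₁ (x∈p∩q⁺ (j∈Y , j∈x)))
    ...   | inj₂ j∈e = x∈p∪q⁺ (inj₂ j∈e)

  deg-insert-away : ∀ Y e x → src e ≢ x → tgt e ≢ x → deg E (Y ∪ ⁅ e ⁆) x ≤ deg E Y x
  deg-insert-away Y e x s≢x t≢x = p⊆q⇒∣p∣≤∣q∣ ⊆Y∩x
    where
    ⊆Y∩x : (Y ∪ ⁅ e ⁆) ∩ inc E x ⊆ Y ∩ inc E x
    ⊆Y∩x j∈ with x∈p∩q⁻ (Y ∪ ⁅ e ⁆) (inc E x) j∈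
    ... | j∈Y∪e , j∈x with x∈p∪q⁻ Y ⁅ e ⁆ j∈Y∪e
    ...   | inj₁ j∈Y = x∈p∩q⁺ (j∈Y , j∈x)
    ...   | inj₂ j∈e with incident⇒endpoint (subst (λ k → k ∈ inc E x) (x∈⁅y⁆⇒x≡y e j∈e) j∈x)
    ...     | inj₁ s≡x = contradiction s≡x s≢x
    ...     | inj₂ t≡x = contradiction t≡x t≢x

  insert-within : ∀ Y e x → Deficient Y (src e) → Deficient Y (tgt e) →
    deg E Y x ≤ c x → deg E (Y ∪ ⁅ e ⁆) x ≤ c x
  insert-within Y e x s-def t-def within with src e ≟ x | tgt e ≟ x
  ... | yes refl | _        = ≤-trans (deg-insert Y e x) s-def
  ... | no _     | yes refl = ≤-trans (deg-insert Y e x) t-def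
  ... | no s≢x   | no t≢x   = ≤-trans (deg-insert-away Y e x s≢x t≢x) within

  insert-feasible : ∀ {Y} e → Deficient Y (src e) → Deficient Y (tgt e) →
    Feasible E c Y → Feasible E c (Y ∪ ⁅ e ⁆)
  insert-feasible {Y} e s-def t-def feasible i i∈ with x∈p∪q⁻ Y ⁅ e ⁆ i∈
  ... | inj₁ i∈Y = Sum.map (within (src i)) (within (tgt i)) (feasible i i∈Y)
    where
    within : ∀ x → deg E Y x ≤ c x → deg E (Y ∪ ⁅ e ⁆) x ≤ c x
    within x = insert-within Y e x s-def t-def
  ... | inj₂ i∈e rewrite x∈⁅y⁆⇒x≡y e i∈e = inj₁ (insert-within Y e (src e) s-def t-def (<⇒≤ s-def))

  rejected⇒saturated : ∀ {Y} e → Feasible E c Y → ¬ Feasible E c (Y ∪ ⁅ e ⁆) →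
    Saturated Y (src e) ⊎ Saturated Y (tgt e)
  rejected⇒saturated {Y} e feasible infeasible
    with deg E Y (src e) <? c (src e) | deg E Y (tgt e) <? c (tgt e)
  ... | no s-sat    | _          = inj₁ (≮⇒≥ s-sat)
  ... | yes _       | no t-sat   = inj₂ (≮⇒≥ t-sat)
  ... | yes s-def   | yes t-def  = contradiction (insert-feasible e s-def t-def feasible) infeasible

  StepResult : Subset m → Fin m → Subset m → Set
  StepResult Y i Y' = Feasible E c Y' × Y ⊆ Y' × Settled Y' i

  addStep-result : ∀ {Y} i → Feasible E c Y → StepResult Y i (addStep E c Y i)
  addStep-result {Y} i feasible = decide (feasible? E c (Y ∪ ⁅ i ⁆))
    where
    decide : (d : Dec (Feasible E c (Y ∪ ⁅ i ⁆))) →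
      StepResult Y i (if does d then Y ∪ ⁅ i ⁆ else Y)
    decide (yes feasible′) = feasible′ , p⊆p∪q ⁅ i ⁆ , inj₁ (x∈p∪q⁺ (inj₂ (x∈⁅x⁆ i)))
    decide (no infeasible) = feasible , (λ i∈ → i∈) , inj₂ (rejected⇒saturated i feasible infeasible)

  addSteps-result : ∀ (is : List (Fin m)) {Y} → Feasible E c Y →
    let Y' = foldl (addStep E c) Y is in
    Feasible E c Y' × Y ⊆ Y' × (∀ i → i List.∈ is → Settled Y' i)
  addSteps-result []       feasible = feasible , (λ i∈ → i∈) , λ _ ()
  addSteps-result (i ∷ is) feasible
    with addStep-result i feasible
  ... | feasible₁ , Y⊆Y₁ , settled₁ with addSteps-result is feasible₁
  ...   | feasible₂ , Y₁⊆Y₂ , settled₂ =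
    feasible₂ , (λ j∈ → Y₁⊆Y₂ (Y⊆Y₁ j∈)) , λ where
      j (Any.here refl) → settled-mono j Y₁⊆Y₂ settled₁
      j (Any.there j∈)  → settled₂ j j∈

  ⊥-feasible : Feasible E c ⊥
  ⊥-feasible _ i∈⊥ = contradiction i∈⊥ ∉⊥

  edgeAddition-feasible×maximal : ∀ π →
    Feasible E c (edgeAddition E c π) × (∀ i → Settled (edgeAddition E c π) i)
  edgeAddition-feasible×maximal π with addSteps-result (map (π ⟨$⟩ʳ_) (allFin m)) ⊥-feasible
  ... | feasible , _ , settled = feasible , λ i → settled i (scheduled π i)

  module _ {Y : Subset m} (maximal : ∀ i → Settled Y i)
           {S : Fin n → Subset m} (valid : ValidSelection E c Y S) where

    private
      Z : Subset m
      Z = selectZ E c Y S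

    listed⇒deficient : ∀ {w} → w List.∈ deficient E c Y → Deficient Y w
    listed⇒deficient w∈ = proj₂ (∈-filter⁻ (λ x → deg E Y x <? c x) {xs = allFin n} w∈)

    selected⇒outside×incident : ∀ {w j} → Deficient Y w → j ∈ S w → j ∉ Y × j ∈ inc E w
    selected⇒outside×incident {w} w-def j∈Sw
      with x∈p∩q⁻ (∁ Y) (inc E w) (proj₁ (valid w w-def) j∈Sw)
    ... | j∈∁Y , j∈w = x∈∁p⇒x∉p j∈∁Y , j∈w

    -- By maximality, the Z-edges at a deficient w were all selected for w itself.
    Z-at-deficient : ∀ {w} → Deficient Y w → Z ∩ inc E w ⊆ S w
    Z-at-deficient {w} w-def {j} j∈ with x∈p∩q⁻ Z (inc E w) j∈
    ... | j∈Z , j∈w with ∈-⋃-map S (deficient E c Y) j∈Z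
    ...   | w' , w'∈A , j∈Sw' with w' ≟ w
    ...     | yes refl = j∈Sw'
    ...     | no w'≢w  = contradiction (maximal j)
      (deficient-edge-unsettled j∉Y (joins j∈w j∈w' w'≢w) w-def w'-def)
      where
      w'-def : Deficient Y w'
      w'-def = listed⇒deficient w'∈A
      j∉Y×j∈w' : j ∉ Y × j ∈ inc E w'
      j∉Y×j∈w' = selected⇒outside×incident w'-def j∈Sw'
      j∉Y = proj₁ j∉Y×j∈w'
      j∈w' = proj₂ j∉Y×j∈w'

    deg-Z-within : ∀ {w} → Deficient Y w → deg E Z w ≤ c w
    deg-Z-within {w} w-def = begin
      deg E Z w             ≤⟨ p⊆q⇒∣p∣≤∣q∣ (Z-at-deficient w-def) ⟩
      ∣ S w ∣               ≡⟨ proj₂ (valid w w-def) ⟩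
      c w ∸ deg E Y w       ≤⟨ m∸n≤m (c w) (deg E Y w) ⟩
      c w                   ∎
      where open ≤-Reasoning

    -- Every edge of Z has a deficient endpoint, where the degree bound applies.
    selectZ-feasible : Feasible E c Z
    selectZ-feasible i i∈Z with ∈-⋃-map S (deficient E c Y) i∈Z
    ... | w , w∈A , i∈Sw
      with incident⇒endpoint (proj₂ (selected⇒outside×incident (listed⇒deficient w∈A) i∈Sw))
    ...   | inj₁ refl = inj₁ (deg-Z-within (listed⇒deficient w∈A))
    ...   | inj₂ refl = inj₂ (deg-Z-within (listed⇒deficient w∈A))

lemma2 : ∀ {n m} (E : Edges n m) → Simple E → Connected E →
    (c : Fin n → ℕ) → (∀ v → c v ≤ deg E ⊤ v) →
    (π : Permutation′ m) →
    (S : Fin n → Subset m) → ValidSelection E c (edgeAddition E c π) S →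
    Feasible E c (output E c π S)
lemma2 E _ _ c _ π S valid
  with edgeAddition-feasible×maximal E c π
... | Y-feasible , Y-maximal =
  if-preserves (Feasible E c) (does (∣ Z ∣ ≤? ∣ Y ∣))
    Y-feasible (selectZ-feasible E c Y-maximal valid)
  where
  Y = edgeAddition E c π
  Z = selectZ E c Y S
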